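{- Let $k \ge 2$, $2 \le r \le k$ and $m, n \ge r$. Let $H$ be any subgraph of $P_m \Box P_n$ isomorphic to $P_r \Box P_r$. Then in every successful layout of $d_k(P_m \Box P_n)$ searchers on $P_m \Box P_n$ in the $k$-move deduction game, at least $r$ distinct searchers each occupy at least one vertex of $H$ at some point during the game (either initially or by moving onto it).
   Context: $P_n$ is the path on $n$ vertices; $P_m \Box P_n$ is the Cartesian product ($m\times n$ grid): vertices $(i,j)$, $0\le i\le m-1$, $0\le j\le n-1$, with $(i,j)$ adjacent to $(i',j')$ iff ($|i-i'|=1$ and $j=j'$) or ($i=i'$ and $|j-j'|=1$). The $k$-move deduction game ($k$ a positive integer) on a finite graph $G$: a layout places a finite number of searchers on vertices of $G$ (several searchers may share a vertex). Every searcher is initially mobile. A vertex is protected once it has been occupied by some searcher (so initially occupied vertices are protected); other vertices are unprotected. The game proceeds in stages. At each stage, for every vertex $v$ that has at least one unprotected neighbour: if the number of mobile searchers on $v$ is at least the number of unprotected neighbours of $v$, then the mobile searchers on $v$ move to the unprotected neighbours of $v$ so that each unprotected neighbour receives at least one searcher; excess mobile searchers on $v$ may also move to any of these unprotected neighbours. All moves in a stage happen simultaneously, newly occupied vertices become protected, and a searcher that has moved $k$ times becomes immobile. The process repeats until all vertices are protected or no searcher can move. A layout is successful if all vertices of $G$ end up protected. The $k$-move deduction number $d_k(G)$ is the minimum number of searchers in a successful layout on $G$. -}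

module Defs where

open import Data.Nat using (ℕ; zero; suc; _+_; _≤_; _<_; _≤ᵇ_; _<ᵇ_; _≡ᵇ_; ∣_-_∣)
open import Data.Fin using (Fin; toℕ)
open import Data.Product using (_×_; _,_; ∃)
open import Data.Sum using (_⊎_)
open import Data.Bool using (Bool; true; false; _∧_; _∨_; not; T)
open import Data.List using (List; []; _∷_; upTo; allFin; map; concatMap)
open import Data.Bool.ListAction using (any)
open import Relation.Binary.PropositionalEquality using (_≡_)

Vertex : ℕ → ℕ → Set
Vertex m n = Fin m × Fin n

vertices : (m n : ℕ) → List (Vertex m n)
vertices m n = concatMap (λ i → map (λ j → (i , j)) (allFin n)) (allFin m)

eqV : {m n : ℕ} → Vertex m n → Vertex m n → Bool
eqV (i , j) (i' , j') = (toℕ i ≡ᵇ toℕ i') ∧ (toℕ j ≡ᵇ toℕ j')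

adjᵇ : {m n : ℕ} → Vertex m n → Vertex m n → Bool
adjᵇ (i , j) (i' , j') =
  ((∣ toℕ i - toℕ i' ∣ ≡ᵇ 1) ∧ (toℕ j ≡ᵇ toℕ j'))
  ∨ ((toℕ i ≡ᵇ toℕ i') ∧ (∣ toℕ j - toℕ j' ∣ ≡ᵇ 1))

Adj : {m n : ℕ} → Vertex m n → Vertex m n → Set
Adj u v = T (adjᵇ u v)

count : {A : Set} → (A → Bool) → List A → ℕ
count p [] = 0
count p (x ∷ xs) with p x
... | true  = suc (count p xs)
... | false = count p xs

-- A play with s searchers: pos t a is the vertex occupied by searcher a
-- after t stages (pos 0 is the layout).
Play : ℕ → ℕ → ℕ → Set
Play m n s = ℕ → Fin s → Vertex m n

module _ {m n s : ℕ} (k : ℕ) (pos : Play m n s) where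

  prot : ℕ → Vertex m n → Bool
  prot t v = any (λ t' → any (λ a → eqV (pos t' a) v) (allFin s)) (upTo (suc t))

  movesBefore : ℕ → Fin s → ℕ
  movesBefore t a = count (λ t' → not (eqV (pos t' a) (pos (suc t') a))) (upTo t)

  mobile : ℕ → Fin s → Bool
  mobile t a = movesBefore t a <ᵇ k

  unprotNbrs : ℕ → Vertex m n → ℕ
  unprotNbrs t v = count (λ w → adjᵇ v w ∧ not (prot t w)) (vertices m n)

  mobileOn : ℕ → Vertex m n → ℕ
  mobileOn t v = count (λ a → eqV (pos t a) v ∧ mobile t a) (allFin s)

  fires : ℕ → Vertex m n → Bool
  fires t v = (1 ≤ᵇ unprotNbrs t v) ∧ (unprotNbrs t v ≤ᵇ mobileOn t v)

  LegalStage : ℕ → Set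
  LegalStage t =
    (∀ a → T (mobile t a ∧ fires t (pos t a)) →
       (pos (suc t) a ≡ pos t a)
       ⊎ (Adj (pos t a) (pos (suc t) a) × T (not (prot t (pos (suc t) a)))))
    × (∀ a → T (not (mobile t a ∧ fires t (pos t a))) → pos (suc t) a ≡ pos t a)
    × (∀ v w → T (fires t v) → Adj v w → T (not (prot t w)) →
         ∃ λ a → (pos t a ≡ v) × T (mobile t a) × (pos (suc t) a ≡ w))

  SuccessfulPlay : ℕ → Set
  SuccessfulPlay len = (∀ t → t < len → LegalStage t) × (∀ v → T (prot len v))

SuccessfulLayout : (k m n s : ℕ) → (Fin s → Vertex m n) → Set
SuccessfulLayout k m n s L =
  ∃ λ (pos : Play m n s) → ∃ λ len → (∀ a → pos 0 a ≡ L a) × SuccessfulPlay k pos len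

IsDeductionNumber : (k m n d : ℕ) → Set
IsDeductionNumber k m n d =
  (∃ λ (L : Fin d → Vertex m n) → SuccessfulLayout k m n d L)
  × (∀ s (L : Fin s → Vertex m n) → SuccessfulLayout k m n s L → d ≤ s)

{-# OPTIONS --safe #-}
-- Look at the first stage after which some row of H is fully protected.  If
-- that is the initial layout, the r vertices of that row carry r searchers.
-- Otherwise, just before that stage, either some row of H is entirely
-- unprotected, or every row contains a protected and an unprotected vertex.
-- A protected vertex with an unprotected neighbour is still occupied: its
-- searchers could only leave by firing, which would protect that neighbour.
-- So in the second case every row of H contains an occupied vertex.  In the
-- first case, right after the stage every column of H contains a newly
-- occupied vertex (where it meets the empty row) or is mixed again.  Either
-- way r pairwise disjoint lines of H are occupied at one time, by r distinct
-- searchers.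
module Submission where

open import Defs
open import Data.Bool using (true; false; T; not; _∧_)
open import Data.Bool.Properties using (T-∧; T-∨)
open import Data.Empty using (⊥-elim)
open import Data.Fin using (Fin; zero; suc; toℕ; inject₁; fromℕ<)
open import Data.Fin.Properties using (toℕ-injective; toℕ-inject₁; any?; all?; ¬∀⟶∃¬)
open import Data.List using (upTo; allFin)
open import Data.List.Membership.Propositional using (find; lose)
open import Data.List.Membership.Propositional.Properties using (∈-upTo⁺; ∈-upTo⁻; ∈-allFin)
open import Data.List.Relation.Unary.Any using (satisfied)
open import Data.List.Relation.Unary.Any.Properties using (any⁺; any⁻)
open import Data.Nat using (ℕ; zero; suc; _≤_; _<_; _≤′_; ≤′-refl; ≤′-step; z≤n; s≤s; ∣_-_∣)
open import Data.Nat.Properties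
  using (≤-refl; ≤-trans; ≤-pred; <⇒≤; n≤1+n; m≤n⇒m≤1+n; n≤0⇒n≡0; ≤⇒≤′; ≤′⇒≤; ≡ᵇ⇒≡; ≡⇒≡ᵇ; ∣-∣-comm)
open import Data.Product using (_×_; ∃; ∃₂; _,_; proj₁; proj₂)
open import Data.Sum using (_⊎_; inj₁; inj₂)
open import Data.Unit using (tt)
open import Function using (_∘_; Equivalence)
open import Relation.Nullary using (¬_; Dec; yes; no)
open import Relation.Nullary.Decidable using (T?; ¬?; decidable-stable)
open import Relation.Unary using (Decidable)
open import Relation.Binary.PropositionalEquality
  using (_≡_; refl; sym; trans; cong; cong₂; subst; module ≡-Reasoning)

open Equivalence using (to; from)

¬T⇒T-not : ∀ {b} → ¬ T b → T (not b)
¬T⇒T-not {true}  ¬t = ⊥-elim (¬t tt)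
¬T⇒T-not {false} _  = tt

eqV⇒≡ : ∀ {m n} {u v : Vertex m n} → T (eqV u v) → u ≡ v
eqV⇒≡ {u = i , j} {i' , j'} h =
  let i≡i' , j≡j' = to T-∧ h
  in cong₂ _,_ (toℕ-injective (≡ᵇ⇒≡ _ _ i≡i')) (toℕ-injective (≡ᵇ⇒≡ _ _ j≡j'))

≡⇒eqV : ∀ {m n} {u v : Vertex m n} → u ≡ v → T (eqV u v)
≡⇒eqV {u = i , j} refl = from T-∧ (≡⇒≡ᵇ (toℕ i) _ refl , ≡⇒≡ᵇ (toℕ j) _ refl)

Neighbours : ∀ {r} → Fin r → Fin r → Set
Neighbours y x = ∣ toℕ y - toℕ x ∣ ≡ 1

∣n-1+n∣≡1 : ∀ n → ∣ n - suc n ∣ ≡ 1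
∣n-1+n∣≡1 zero    = refl
∣n-1+n∣≡1 (suc n) = ∣n-1+n∣≡1 n

inject₁-suc-neighbours : ∀ {r} (y : Fin r) → Neighbours (inject₁ y) (suc y)
inject₁-suc-neighbours y rewrite toℕ-inject₁ y = ∣n-1+n∣≡1 (toℕ y)

neighbours-sym : ∀ {r} {y x : Fin r} → Neighbours y x → Neighbours x y
neighbours-sym {y = y} {x} = trans (∣-∣-comm (toℕ x) (toℕ y))

switch-from-zero : ∀ {r} {P : Fin (suc r) → Set} → Decidable P → ∀ b → P zero → ¬ P b →
  ∃ λ (y : Fin r) → P (inject₁ y) × ¬ P (suc y)
switch-from-zero P? zero p₀ ¬pb = ⊥-elim (¬pb p₀)
switch-from-zero {zero} P? (suc ())
switch-from-zero {suc r} {P} P? (suc b) p₀ ¬pb with P? (suc zero)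
... | no ¬p₁ = zero , p₀ , ¬p₁
... | yes p₁ =
  let y , py , ¬psy = switch-from-zero {P = P ∘ suc} (P? ∘ suc) b p₁ ¬pb
  in suc y , py , ¬psy

discrete-ivt : ∀ {r} {P : Fin r → Set} → Decidable P → ∀ {a b} → P a → ¬ P b →
  ∃₂ λ y x → Neighbours y x × P y × ¬ P x
discrete-ivt {suc r} P? {a} {b} pa ¬pb with P? zero
... | yes p₀ =
  let y , py , ¬psy = switch-from-zero P? b p₀ ¬pb
  in inject₁ y , suc y , inject₁-suc-neighbours y , py , ¬psy
... | no ¬p₀ =
  let y , ¬py , ¬¬psy = switch-from-zero (¬? ∘ P?) a ¬p₀ (λ ¬pa → ¬pa pa)
  in suc y , inject₁ y , neighbours-sym {y = inject₁ y} (inject₁-suc-neighbours y) ,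
     decidable-stable (P? (suc y)) ¬¬psy , ¬py

initially-or-switches-on : ∀ {P : ℕ → Set} → Decidable P → ∀ {t} → P t →
  P 0 ⊎ ∃ λ t₀ → suc t₀ ≤ t × ¬ P t₀ × P (suc t₀)
initially-or-switches-on P? {zero} p₀ = inj₁ p₀
initially-or-switches-on P? {suc t} pt with P? t
... | no ¬pt = inj₂ (t , ≤-refl , ¬pt , pt)
... | yes pt' with initially-or-switches-on P? pt'
...   | inj₁ p₀                    = inj₁ p₀
...   | inj₂ (t₀ , t₀<t , ¬pt₀ , p) = inj₂ (t₀ , m≤n⇒m≤1+n t₀<t , ¬pt₀ , p)

row-adjacent : ∀ {r c} (i : Fin r) {y x : Fin c} → Neighbours y x → Adj (i , y) (i , x)
row-adjacent i y~x = from T-∨ (inj₂ (from T-∧ (≡⇒≡ᵇ (toℕ i) _ refl , ≡⇒≡ᵇ _ 1 y~x)))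

column-adjacent : ∀ {r c} (j : Fin c) {y x : Fin r} → Neighbours y x → Adj (y , j) (x , j)
column-adjacent j y~x = from T-∨ (inj₁ (from T-∧ (≡⇒≡ᵇ _ 1 y~x , ≡⇒≡ᵇ (toℕ j) _ refl)))

IsPath : ∀ {r m n} → (Fin r → Vertex m n) → Set
IsPath ℓ = ∀ {y x} → Neighbours y x → Adj (ℓ y) (ℓ x)

module Protection {m n s : ℕ} (k : ℕ) (pos : Play m n s) where

  Protected : ℕ → Vertex m n → Set
  Protected t v = T (prot k pos t v)

  Occupied : ℕ → Vertex m n → Set
  Occupied t v = ∃ λ a → pos t a ≡ v

  protected⇒occupied-earlier : ∀ {t v} → Protected t v → ∃ λ t' → t' ≤ t × Occupied t' v
  protected⇒occupied-earlier {t} {v} h =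
    let t' , t'∈ , h' = find (any⁻ _ (upTo (suc t)) h)
        a , a-at-v     = satisfied (any⁻ _ (allFin s) h')
    in t' , ≤-pred (∈-upTo⁻ t'∈) , a , eqV⇒≡ a-at-v

  occupied⇒protected : ∀ {t' t v} → t' ≤ t → Occupied t' v → Protected t v
  occupied⇒protected t'≤t (a , a-at-v) =
    any⁺ _ (lose (∈-upTo⁺ (s≤s t'≤t)) (any⁺ _ (lose (∈-allFin a) (≡⇒eqV a-at-v))))

  protected-mono : ∀ {t t' v} → t ≤ t' → Protected t v → Protected t' v
  protected-mono {t} t≤t' h =
    let _ , t''≤t , occ = protected⇒occupied-earlier {t} h
    in occupied⇒protected (≤-trans t''≤t t≤t') occ

  initially-protected⇒occupied : ∀ {v} → Protected 0 v → Occupied 0 v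
  initially-protected⇒occupied h with protected⇒occupied-earlier h
  ... | t' , t'≤0 , occ rewrite n≤0⇒n≡0 t'≤0 = occ

  newly-protected⇒occupied : ∀ {t v} → ¬ Protected t v → Protected (suc t) v → Occupied (suc t) v
  newly-protected⇒occupied ¬pv pv with protected⇒occupied-earlier pv
  ... | t' , t'≤1+t , occ with ≤⇒≤′ t'≤1+t
  ...   | ≤′-refl      = occ
  ...   | ≤′-step t'≤t = ⊥-elim (¬pv (occupied⇒protected (≤′⇒≤ t'≤t) occ))

module LegalPlay {m n s : ℕ} (k : ℕ) (pos : Play m n s) (len : ℕ)
                 (legal : ∀ t → t < len → LegalStage k pos t) where
  open Protection k pos

  -- A searcher leaves y only if y fires, and a firing y sends a searcher to
  -- each of its unprotected neighbours.
  stays-beside-unprotected : ∀ {t a y x} → suc t ≤ len → Adj y x → ¬ Protected (suc t) x →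
    pos t a ≡ y → pos (suc t) a ≡ y
  stays-beside-unprotected {t} {a} {y} {x} t<len y~x ¬px a-at-y
    with mobile k pos t a ∧ fires k pos t (pos t a) in moves
  ... | false = trans (proj₁ (proj₂ (legal t t<len)) a (subst (T ∘ not) (sym moves) tt)) a-at-y
  ... | true =
    let a-fires    = proj₂ (to (T-∧ {mobile k pos t a}) (subst T (sym moves) tt))
        y-fires    = subst (T ∘ fires k pos t) a-at-y a-fires
        ¬px-before = ¬T⇒T-not (λ px → ¬px (protected-mono (n≤1+n t) px))
        b , _ , _ , b-at-x = proj₂ (proj₂ (legal t t<len)) y x y-fires y~x ¬px-before
    in ⊥-elim (¬px (occupied⇒protected ≤-refl (b , b-at-x)))

  boundary-occupied : ∀ {t y x} → t ≤ len → Adj y x → Protected t y → ¬ Protected t x → Occupied t y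
  boundary-occupied {t} {y} {x} t≤len y~x py ¬px =
    let t' , t'≤t , a , a-at-y = protected⇒occupied-earlier py
    in a , stays (≤⇒≤′ t'≤t) t≤len ¬px a-at-y
    where
    stays : ∀ {t' t a} → t' ≤′ t → t ≤ len → ¬ Protected t x → pos t' a ≡ y → pos t a ≡ y
    stays ≤′-refl _ _ a-at-y = a-at-y
    stays {t = suc t} (≤′-step t'≤t) t<len ¬px a-at-y =
      stays-beside-unprotected t<len y~x ¬px
        (stays t'≤t (<⇒≤ t<len) (λ px → ¬px (protected-mono (n≤1+n t) px)) a-at-y)

  mixed-path-occupied : ∀ {r t} (ℓ : Fin r → Vertex m n) → IsPath ℓ → t ≤ len →
    ∀ {a b} → Protected t (ℓ a) → ¬ Protected t (ℓ b) → ∃ λ c → Occupied t (ℓ c)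
  mixed-path-occupied {t = t} ℓ path t≤len pa ¬pb =
    let y , x , y~x , py , ¬px = discrete-ivt (λ c → T? (prot k pos t (ℓ c))) pa ¬pb
    in y , boundary-occupied t≤len (path y~x) py ¬px

module SubgridVisits {m n d r : ℕ} (k : ℕ) (pos : Play m n d) (len : ℕ)
                     (play : SuccessfulPlay k pos len) (φ : Vertex r r → Vertex m n)
                     (φ-injective : ∀ x y → φ x ≡ φ y → x ≡ y)
                     (φ-adjacent : ∀ x y → Adj x y → Adj (φ x) (φ y)) where
  open Protection k pos
  open LegalPlay k pos len (proj₁ play)

  VisitedByDistinct : Set
  VisitedByDistinct = ∃ λ (f : Fin r → Fin d) → (∀ i j → f i ≡ f j → i ≡ j)
    × (∀ i → ∃ λ t → (t ≤ len) × ∃ λ x → pos t (f i) ≡ φ x)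

  distinct-occupants : ∀ {t} → t ≤ len → (key : Vertex r r → Fin r) →
    (∀ c → ∃ λ x → key x ≡ c × Occupied t (φ x)) → VisitedByDistinct
  distinct-occupants {t} t≤len key occupied =
    searcher , searcher-injective , λ c → t , t≤len , vertex c , at-vertex c
    where
    vertex : Fin r → Vertex r r
    vertex c = proj₁ (occupied c)
    searcher : Fin r → Fin d
    searcher c = proj₁ (proj₂ (proj₂ (occupied c)))
    at-vertex : ∀ c → pos t (searcher c) ≡ φ (vertex c)
    at-vertex c = proj₂ (proj₂ (proj₂ (occupied c)))
    searcher-injective : ∀ c c' → searcher c ≡ searcher c' → c ≡ c'
    searcher-injective c c' same = begin
      c                ≡⟨ sym (proj₁ (proj₂ (occupied c))) ⟩
      key (vertex c)   ≡⟨ cong key (φ-injective _ _ same-vertex) ⟩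
      key (vertex c')  ≡⟨ proj₁ (proj₂ (occupied c')) ⟩
      c'               ∎
      where
      open ≡-Reasoning
      same-vertex : φ (vertex c) ≡ φ (vertex c')
      same-vertex = trans (sym (at-vertex c)) (trans (cong (pos t) same) (at-vertex c'))

  row : Fin r → Fin r → Vertex m n
  row i c = φ (i , c)

  column : Fin r → Fin r → Vertex m n
  column c i = φ (i , c)

  row-path : ∀ i → IsPath (row i)
  row-path i {y} {x} y~x = φ-adjacent (i , y) (i , x) (row-adjacent i {y} {x} y~x)

  column-path : ∀ c → IsPath (column c)
  column-path c {y} {x} y~x = φ-adjacent (y , c) (x , c) (column-adjacent c {y} {x} y~x)

  FullRow : ℕ → Fin r → Set
  FullRow t i = ∀ c → Protected t (row i c)

  EmptyRow : ℕ → Fin r → Set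
  EmptyRow t i = ∀ c → ¬ Protected t (row i c)

  columns-occupied : ∀ {t i j} → suc t ≤ len → FullRow (suc t) i → EmptyRow t j →
    ∀ c → ∃ λ x → proj₂ x ≡ c × Occupied (suc t) (φ x)
  columns-occupied {t} {j = j} t<len full empty c with T? (prot k pos (suc t) (column c j))
  ... | yes pj = (j , c) , refl , newly-protected⇒occupied (empty c) pj
  ... | no ¬pj =
    let i' , occ = mixed-path-occupied (column c) (column-path c) t<len (full c) ¬pj
    in (i' , c) , refl , occ

  rows-occupied : ∀ {t} → t ≤ len → ¬ ∃ (FullRow t) → ¬ ∃ (EmptyRow t) →
    ∀ j → ∃ λ x → proj₁ x ≡ j × Occupied t (φ x)
  rows-occupied {t} t≤len no-full no-empty j =
    let c  , ¬¬pc = ¬∀⟶∃¬ r _ (λ c → ¬? (protected? c)) (λ empty → no-empty (j , empty))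
        c' , ¬pc' = ¬∀⟶∃¬ r _ protected? (λ full → no-full (j , full))
        pc        = decidable-stable (protected? c) ¬¬pc
        y , occ   = mixed-path-occupied (row j) (row-path j) t≤len pc ¬pc'
    in (j , y) , refl , occ
    where
    protected? : Decidable (Protected t ∘ row j)
    protected? c = T? (prot k pos t (row j c))

  full-row? : ∀ t → Dec (∃ (FullRow t))
  full-row? t = any? λ i → all? λ c → T? (prot k pos t (row i c))

  empty-row? : ∀ t → Dec (∃ (EmptyRow t))
  empty-row? t = any? λ i → all? λ c → ¬? (T? (prot k pos t (row i c)))

  visited-by-distinct : 0 < r → VisitedByDistinct
  visited-by-distinct 0<r
    with initially-or-switches-on full-row? (fromℕ< 0<r , λ c → proj₂ play _)
  ... | inj₁ (i , full) =
    distinct-occupants z≤n proj₂ (λ c → (i , c) , refl , initially-protected⇒occupied (full c))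
  ... | inj₂ (t , t<len , no-full , i , full) with empty-row? t
  ...   | yes (j , empty) = distinct-occupants t<len proj₂ (columns-occupied t<len full empty)
  ...   | no no-empty     =
    distinct-occupants (<⇒≤ t<len) proj₁ (rows-occupied (<⇒≤ t<len) no-full no-empty)

lemma4p5 : (k r m n : ℕ) → 2 ≤ k → 2 ≤ r → r ≤ k → r ≤ m → r ≤ n →
    (φ : Vertex r r → Vertex m n) →
    (∀ x y → φ x ≡ φ y → x ≡ y) →
    (∀ x y → Adj x y → Adj (φ x) (φ y)) →
    (d : ℕ) → IsDeductionNumber k m n d →
    (pos : Play m n d) (len : ℕ) → SuccessfulPlay k pos len →
    ∃ λ (f : Fin r → Fin d) → (∀ i j → f i ≡ f j → i ≡ j)
      × (∀ i → ∃ λ t → (t ≤ len) × ∃ λ x → pos t (f i) ≡ φ x)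
lemma4p5 k r m n _ 2≤r _ _ _ φ φ-injective φ-adjacent d _ pos len play =
  SubgridVisits.visited-by-distinct k pos len play φ φ-injective φ-adjacent
    (≤-trans (s≤s z≤n) 2≤r)
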